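{- Fix $k \geq 2$ and $n \ge 2$. Let $L^{(k)}_n$ be the set of permutations in $S_n$ whose support $\{i\in[n] : \pi(i)\neq i\}$ has size at most $k$. Then \[ \mathrm{diam}(\mathrm{Cay}(S_n, L^{(k)}_{n})) \leq \left\lceil \frac{n-1}{k-1}\right\rceil. \]
   Context: $\mathrm{Cay}(S_n,\Gamma)$ is the Cayley graph with vertex set $S_n$ in which $\pi$ and $\pi\gamma$ are adjacent for each $\gamma \in \Gamma$; its diameter is the maximum graph distance between two vertices. -}

module Defs where

open import Data.Nat using (ℕ; zero; suc; _+_; _≤_; _/_)
open import Data.Fin using (Fin; _≟_)
open import Data.Fin.Permutation using (Permutation′; _⟨$⟩ʳ_; _≈_; _∘ₚ_)
open import Data.List using (List; length; filter; allFin)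
open import Data.Product using (Σ; _×_)
open import Data.Sum using (_⊎_)
open import Relation.Nullary using (¬?)

Sym : ℕ → Set
Sym n = Permutation′ n

-- group product πγ in S_n, with the usual convention (πγ)(i) = π(γ(i))
_·_ : ∀ {n} → Sym n → Sym n → Sym n
π · γ = γ ∘ₚ π

support : ∀ {n} → Sym n → List (Fin n)
support {n} π = filter (λ i → ¬? ((π ⟨$⟩ʳ i) ≟ i)) (allFin n)

supportSize : ∀ {n} → Sym n → ℕ
supportSize π = length (support π)

L : (k n : ℕ) → Sym n → Set
L k n π = supportSize π ≤ k

Adj : ∀ {n} → (Sym n → Set) → Sym n → Sym n → Set
Adj {n} Γ π τ = Σ (Sym n) (λ γ → Γ γ × ((τ ≈ π · γ) ⊎ (π ≈ τ · γ)))

data Walk {n} (Γ : Sym n → Set) : Sym n → Sym n → ℕ → Set where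
  nil  : ∀ {π σ} → π ≈ σ → Walk Γ π σ zero
  cons : ∀ {π τ σ m} → Adj Γ π τ → Walk Γ τ σ m → Walk Γ π σ (suc m)

DistLe : ∀ {n} → (Sym n → Set) → Sym n → Sym n → ℕ → Set
DistLe Γ π σ d = Σ ℕ (λ m → m ≤ d × Walk Γ π σ m)

DiamLe : ∀ {n} → (Sym n → Set) → ℕ → Set
DiamLe {n} Γ d = (π σ : Sym n) → DistLe Γ π σ d

-- ⌈ a / (k - 1) ⌉, meaningful for k ≥ 2 (value 0 otherwise, never used)
ceilDivPred : ℕ → ℕ → ℕ
ceilDivPred a (suc (suc j)) = (a + j) / suc j
ceilDivPred a _ = 0

-- Write σ = π · ρ; it suffices to factor ρ into ⌈(n - 1)/(k - 1)⌉ permutations moving at most k points each.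
-- A factor is peeled off greedily along a current point c: if ρ moves c to d, then ρ = (d c) · ρ′ where ρ′ fixes c
-- and every point fixed by ρ, and peeling continues at d; if ρ fixes c, it jumps to any point that ρ moves.
-- Each step lowers ∣moved ρ ∪ {c}∣ by one and adds at most one point to those touched by the factor built so far,
-- so k - 1 steps yield a factor moving at most k points and a remainder moving k - 1 fewer points than ρ (or none).
-- A permutation moving at most one point is the identity, so ⌈(n - 1)/(k - 1)⌉ rounds exhaust any ρ ∈ S_n.

module Submission where

open import Defs
open import Data.Nat using (ℕ; zero; suc; _+_; _*_; _∸_; _≤_; _<_; _/_; _%_; z≤n; s≤s; s≤s⁻¹)
open import Data.Nat.Properties
  using (≤-refl; ≤-trans; ≤-reflexive; n≤1+n; +-suc; +-comm; +-monoʳ-≤; +-monoˡ-≤; +-cancelʳ-≤;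
         ∸-monoˡ-≤; ∸-+-assoc; m+n∸m≡n; m≤n+m∸n; module ≤-Reasoning)
open import Data.Nat.DivMod using (m≡m%n+[m/n]*n; m%n<n)
open import Data.Fin using (Fin; zero; suc; _≟_)
open import Data.Fin.Subset
  using (Subset; inside; outside; ⁅_⁆; _∪_; ∣_∣; _∈_; _∉_; _⊆_; _⊂_; Nonempty; Empty)
open import Data.Fin.Subset.Properties
  using (x∈⁅x⁆; x∈⁅y⁆⇒x≡y; x≢y⇒x∉⁅y⁆; ∣⁅x⁆∣≡1; ∣⊥∣≡0; ∣p∣≤n; ∣p∣≤∣p∪q∣; p⊆q⇒∣p∣≤∣q∣;
         p⊂q⇒∣p∣<∣q∣; p⊆p∪q; q⊆p∪q; x∈p∪q⁺; x∈p∪q⁻; Empty-unique; nonempty?)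
open import Data.Fin.Permutation using (_⟨$⟩ʳ_; _≈_; id; flip; transpose; inverseʳ)
import Data.Fin.Permutation.Components as PC
open import Data.List using (length; filter)
import Data.List as List
open import Data.Vec using ([]; _∷_; tabulate)
open import Data.Vec.Properties using (lookup∘tabulate; lookup⇒[]=; []=⇒lookup)
open import Data.Product using (∃₂; _×_; _,_; proj₂)
open import Data.Sum using (inj₁; inj₂; [_,_]′)
open import Data.Empty using (⊥-elim)
open import Function using (_∘_)
open import Function.Bundles using (Injection)
open import Function.Properties.Inverse using (Inverse⇒Injection)
open import Relation.Nullary using (yes; no; does; ¬?; contradiction)
open import Relation.Nullary.Decidable using (dec-true)
open import Relation.Unary using (Pred; Decidable)
open import Relation.Binary.PropositionalEquality using (_≡_; _≢_; refl; sym; trans; cong; subst)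

private
  variable
    n : ℕ

∣p∪q∣≤∣p∣+∣q∣ : (p q : Subset n) → ∣ p ∪ q ∣ ≤ ∣ p ∣ + ∣ q ∣
∣p∪q∣≤∣p∣+∣q∣ []            []            = z≤n
∣p∪q∣≤∣p∣+∣q∣ (inside  ∷ p) (inside  ∷ q) =
  s≤s (≤-trans (∣p∪q∣≤∣p∣+∣q∣ p q) (+-monoʳ-≤ ∣ p ∣ (n≤1+n ∣ q ∣)))
∣p∪q∣≤∣p∣+∣q∣ (inside  ∷ p) (outside ∷ q) = s≤s (∣p∪q∣≤∣p∣+∣q∣ p q)
∣p∪q∣≤∣p∣+∣q∣ (outside ∷ p) (inside  ∷ q) =
  ≤-trans (s≤s (∣p∪q∣≤∣p∣+∣q∣ p q)) (≤-reflexive (sym (+-suc ∣ p ∣ ∣ q ∣)))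
∣p∪q∣≤∣p∣+∣q∣ (outside ∷ p) (outside ∷ q) = ∣p∪q∣≤∣p∣+∣q∣ p q

Empty⇒∣p∣≡0 : {p : Subset n} → Empty p → ∣ p ∣ ≡ 0
Empty⇒∣p∣≡0 {n} empty = trans (cong ∣_∣ (Empty-unique empty)) (∣⊥∣≡0 n)

∪-lub : {p q r : Subset n} → p ⊆ r → q ⊆ r → p ∪ q ⊆ r
∪-lub {p = p} {q} p⊆r q⊆r x∈ with x∈p∪q⁻ p q x∈
... | inj₁ x∈p = p⊆r x∈p
... | inj₂ x∈q = q⊆r x∈q

⁅x⁆⊆p : {p : Subset n} {x : Fin n} → x ∈ p → ⁅ x ⁆ ⊆ p
⁅x⁆⊆p {p = p} {x} x∈p y∈⁅x⁆ = subst (_∈ p) (sym (x∈⁅y⁆⇒x≡y x y∈⁅x⁆)) x∈p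

∪⁅⁆-⊂ : {p q : Subset n} {x y : Fin n} → p ⊆ q → y ∈ q → x ∉ p → x ≢ y → p ∪ ⁅ y ⁆ ⊂ q ∪ ⁅ x ⁆
∪⁅⁆-⊂ {p = p} {q} {x} {y} p⊆q y∈q x∉p x≢y =
  ∪-lub (λ z∈p → x∈p∪q⁺ (inj₁ (p⊆q z∈p))) (λ z∈⁅y⁆ → x∈p∪q⁺ (inj₁ (⁅x⁆⊆p y∈q z∈⁅y⁆))) ,
  x , x∈p∪q⁺ (inj₂ (x∈⁅x⁆ x)) , [ x∉p , x≢y ∘ x∈⁅y⁆⇒x≡y y ]′ ∘ x∈p∪q⁻ p ⁅ y ⁆

module _ {a p} {A : Set a} {P : Pred A p} (P? : Decidable P) where

  ∣tabulate∣≡length-filter : ∀ {m} (f : Fin m → A) →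
                              ∣ tabulate (does ∘ P? ∘ f) ∣ ≡ length (filter P? (List.tabulate f))
  ∣tabulate∣≡length-filter {zero}  f = refl
  ∣tabulate∣≡length-filter {suc m} f with P? (f zero)
  ... | yes _ = cong suc (∣tabulate∣≡length-filter (f ∘ suc))
  ... | no  _ = ∣tabulate∣≡length-filter (f ∘ suc)

  ∈-tabulate⁺ : ∀ {m} {f : Fin m → A} {i} → P (f i) → i ∈ tabulate (does ∘ P? ∘ f)
  ∈-tabulate⁺ {f = f} {i} px = lookup⇒[]= i _ (trans (lookup∘tabulate _ i) (dec-true (P? (f i)) px))

  ∈-tabulate⁻ : ∀ {m} {f : Fin m → A} {i} → i ∈ tabulate (does ∘ P? ∘ f) → P (f i)
  ∈-tabulate⁻ {f = f} {i} i∈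
    with P? (f i) | trans (sym (lookup∘tabulate (does ∘ P? ∘ f) i)) ([]=⇒lookup i∈)
  ... | yes px | _  = px
  ... | no  _  | ()

Moves : Sym n → Fin n → Set
Moves π i = π ⟨$⟩ʳ i ≢ i

moves? : (π : Sym n) → Decidable (Moves π)
moves? π i = ¬? (π ⟨$⟩ʳ i ≟ i)

moved : Sym n → Subset n
moved π = tabulate (does ∘ moves? π)

supportSize≡∣moved∣ : (π : Sym n) → supportSize π ≡ ∣ moved π ∣
supportSize≡∣moved∣ π = sym (∣tabulate∣≡length-filter (moves? π) (λ i → i))

∈-moved⁺ : (π : Sym n) {i : Fin n} → Moves π i → i ∈ moved π
∈-moved⁺ π = ∈-tabulate⁺ (moves? π) {f = λ i → i}

∈-moved⁻ : (π : Sym n) {i : Fin n} → i ∈ moved π → Moves π i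
∈-moved⁻ π = ∈-tabulate⁻ (moves? π) {f = λ i → i}

∉-moved-id : {i : Fin n} → i ∉ moved id
∉-moved-id i∈ = ∈-moved⁻ id i∈ refl

∣moved-id∣≡0 : ∀ {n} → ∣ moved (id {n}) ∣ ≡ 0
∣moved-id∣≡0 {n} = Empty⇒∣p∣≡0 {p = moved (id {n})} (∉-moved-id ∘ proj₂)

Empty-moved⇒≈id : (π : Sym n) → Empty (moved π) → π ≈ id
Empty-moved⇒≈id π empty i with π ⟨$⟩ʳ i ≟ i
... | yes πi≡i = πi≡i
... | no  πi≢i = contradiction (i , ∈-moved⁺ π πi≢i) empty

⟨$⟩ʳ-injective : (π : Sym n) {i j : Fin n} → π ⟨$⟩ʳ i ≡ π ⟨$⟩ʳ j → i ≡ j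
⟨$⟩ʳ-injective π = Injection.injective (Inverse⇒Injection π)

Moves-image : (π : Sym n) {i : Fin n} → Moves π i → Moves π (π ⟨$⟩ʳ i)
Moves-image π πi≢i ππi≡πi = πi≢i (⟨$⟩ʳ-injective π ππi≡πi)

∣moved∣≤1⇒≈id : (π : Sym n) → ∣ moved π ∣ ≤ 1 → π ≈ id
∣moved∣≤1⇒≈id π ∣moved∣≤1 with nonempty? (moved π)
... | no  empty    = Empty-moved⇒≈id π empty
... | yes (i , i∈) = contradiction (≤-trans 2≤∣moved∣ ∣moved∣≤1) λ { (s≤s ()) }
  where
    πi≢i : Moves π i
    πi≢i = ∈-moved⁻ π i∈
    ⁅i⁆⊂moved : ⁅ i ⁆ ⊂ moved π
    ⁅i⁆⊂moved = ⁅x⁆⊆p i∈ , π ⟨$⟩ʳ i , ∈-moved⁺ π (Moves-image π πi≢i) , x≢y⇒x∉⁅y⁆ πi≢i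
    2≤∣moved∣ : 2 ≤ ∣ moved π ∣
    2≤∣moved∣ = subst (λ s → suc s ≤ ∣ moved π ∣) (∣⁅x⁆∣≡1 i) (p⊂q⇒∣p∣<∣q∣ ⁅i⁆⊂moved)

moved-· : (π γ : Sym n) → moved (π · γ) ⊆ moved π ∪ moved γ
moved-· π γ {i} i∈ with γ ⟨$⟩ʳ i ≟ i
... | no  γi≢i = x∈p∪q⁺ (inj₂ (∈-moved⁺ γ γi≢i))
... | yes γi≡i =
  x∈p∪q⁺ (inj₁ (∈-moved⁺ π (λ πi≡i → ∈-moved⁻ (π · γ) i∈ (trans (cong (π ⟨$⟩ʳ_) γi≡i) πi≡i))))

transpose-matchʳ : (i j : Fin n) → PC.transpose i j j ≡ i
transpose-matchʳ i j with j ≟ i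
... | yes j≡i = j≡i
... | no  _ with j ≟ j
...   | yes _   = refl
...   | no  j≢j = contradiction refl j≢j

transpose-mismatch : {i j k : Fin n} → k ≢ i → k ≢ j → PC.transpose i j k ≡ k
transpose-mismatch {i = i} {j} {k} k≢i k≢j with k ≟ i
... | yes k≡i = contradiction k≡i k≢i
... | no  _ with k ≟ j
...   | yes k≡j = contradiction k≡j k≢j
...   | no  _   = refl

moved-transpose : (i j : Fin n) → moved (transpose i j) ⊆ ⁅ i ⁆ ∪ ⁅ j ⁆
moved-transpose i j {k} k∈ with k ≟ i | k ≟ j
... | yes refl | _        = x∈p∪q⁺ (inj₁ (x∈⁅x⁆ k))
... | no  _    | yes refl = x∈p∪q⁺ (inj₂ (x∈⁅x⁆ k))
... | no  k≢i  | no  k≢j  = contradiction (transpose-mismatch k≢i k≢j) (∈-moved⁻ (transpose i j) k∈)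

touched : Sym n → Fin n → Subset n
touched π c = moved π ∪ ⁅ c ⁆

record Step (ρ : Sym n) (c : Fin n) : Set where
  field
    τ ρ′    : Sym n
    c′      : Fin n
    factor  : ρ ≈ τ · ρ′
    moved-τ : moved τ ⊆ ⁅ c′ ⁆ ∪ ⁅ c ⁆
    shrinks : touched ρ′ c′ ⊂ touched ρ c

step : {ρ : Sym n} → Nonempty (moved ρ) → (c : Fin n) → Step ρ c
step {n} {ρ} (e , e∈) c with ρ ⟨$⟩ʳ c ≟ c
... | yes ρc≡c = record
  { τ       = id
  ; ρ′      = ρ
  ; c′      = e
  ; factor  = λ _ → refl
  ; moved-τ = ⊥-elim ∘ ∉-moved-id
  ; shrinks = ∪⁅⁆-⊂ (λ x∈ → x∈) e∈ (λ c∈ → ∈-moved⁻ ρ c∈ ρc≡c)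
                    (λ c≡e → ∈-moved⁻ ρ e∈ (subst (λ x → ρ ⟨$⟩ʳ x ≡ x) c≡e ρc≡c))
  }
... | no ρc≢c = record
  { τ       = transpose d c
  ; ρ′      = ρ′
  ; c′      = d
  ; factor  = λ _ → sym (inverseʳ (transpose d c))
  ; moved-τ = moved-transpose d c
  ; shrinks = ∪⁅⁆-⊂ moved-ρ′⊆moved-ρ (∈-moved⁺ ρ (Moves-image ρ ρc≢c))
                    (λ c∈ → ∈-moved⁻ ρ′ c∈ (transpose-matchʳ c d)) (ρc≢c ∘ sym)
  }
  where
    d : Fin n
    d = ρ ⟨$⟩ʳ c
    ρ′ : Sym n
    ρ′ = flip (transpose d c) · ρ
    fixed-by-ρ′ : ∀ {i} → ρ ⟨$⟩ʳ i ≡ i → ρ′ ⟨$⟩ʳ i ≡ i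
    fixed-by-ρ′ {i} ρi≡i =
      trans (cong (PC.transpose c d) ρi≡i)
            (transpose-mismatch (ρc≢c ∘ fixed) (Moves-image ρ ρc≢c ∘ fixed))
      where
        fixed : ∀ {x} → i ≡ x → ρ ⟨$⟩ʳ x ≡ x
        fixed i≡x = subst (λ x → ρ ⟨$⟩ʳ x ≡ x) i≡x ρi≡i
    moved-ρ′⊆moved-ρ : moved ρ′ ⊆ moved ρ
    moved-ρ′⊆moved-ρ i∈ = ∈-moved⁺ ρ (∈-moved⁻ ρ′ i∈ ∘ fixed-by-ρ′)

m<n⇒m∸o≤n∸[1+o] : ∀ {m n} o → m < n → m ∸ o ≤ n ∸ suc o
m<n⇒m∸o≤n∸[1+o] {n = n} o m<n = ≤-trans (∸-monoˡ-≤ o (∸-monoˡ-≤ 1 m<n)) (≤-reflexive (∸-+-assoc n 1 o))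

record Peeled (f : ℕ) (ρ : Sym n) (c : Fin n) : Set where
  field
    γ ρ′     : Sym n
    factor   : ρ ≈ γ · ρ′
    γ-small  : ∣ touched γ c ∣ ≤ suc f
    ρ′-small : ∣ moved ρ′ ∣ ≤ ∣ touched ρ c ∣ ∸ f

unpeeled : ∀ {f} {ρ : Sym n} {c} → ∣ moved ρ ∣ ≤ ∣ touched ρ c ∣ ∸ f → Peeled f ρ c
unpeeled {ρ = ρ} {c} ρ-small = record
  { γ        = id
  ; ρ′       = ρ
  ; factor   = λ _ → refl
  ; γ-small  = begin
      ∣ touched id c ∣ ≤⟨ p⊆q⇒∣p∣≤∣q∣ (∪-lub {q = ⁅ c ⁆} (⊥-elim ∘ ∉-moved-id) (λ x∈ → x∈)) ⟩
      ∣ ⁅ c ⁆ ∣        ≡⟨ ∣⁅x⁆∣≡1 c ⟩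
      1                ≤⟨ s≤s z≤n ⟩
      suc _            ∎
  ; ρ′-small = ρ-small
  }
  where open ≤-Reasoning

touched-· : {τ γ : Sym n} {c c′ : Fin n} →
            moved τ ⊆ ⁅ c′ ⁆ ∪ ⁅ c ⁆ → touched (τ · γ) c ⊆ ⁅ c ⁆ ∪ touched γ c′
touched-· {τ = τ} {γ} {c} {c′} moved-τ =
  ∪-lub (λ i∈ → ∪-lub (∪-lub c′-in c-in ∘ moved-τ) γ-in (moved-· τ γ i∈)) c-in
  where
    c-in : ⁅ c ⁆ ⊆ ⁅ c ⁆ ∪ touched γ c′
    c-in = p⊆p∪q (touched γ c′)
    γ-in : moved γ ⊆ ⁅ c ⁆ ∪ touched γ c′
    γ-in = q⊆p∪q ⁅ c ⁆ (touched γ c′) ∘ p⊆p∪q ⁅ c′ ⁆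
    c′-in : ⁅ c′ ⁆ ⊆ ⁅ c ⁆ ∪ touched γ c′
    c′-in = q⊆p∪q ⁅ c ⁆ (touched γ c′) ∘ q⊆p∪q (moved γ) ⁅ c′ ⁆

extend : ∀ {f} {ρ : Sym n} {c} (s : Step ρ c) → Peeled f (Step.ρ′ s) (Step.c′ s) → Peeled (suc f) ρ c
extend {f = f} {ρ} {c} s p = record
  { γ        = S.τ · P.γ
  ; ρ′       = P.ρ′
  ; factor   = λ i → trans (S.factor i) (cong (S.τ ⟨$⟩ʳ_) (P.factor i))
  ; γ-small  = begin
      ∣ touched (S.τ · P.γ) c ∣          ≤⟨ p⊆q⇒∣p∣≤∣q∣ (touched-· {τ = S.τ} {P.γ} S.moved-τ) ⟩
      ∣ ⁅ c ⁆ ∪ touched P.γ S.c′ ∣       ≤⟨ ∣p∪q∣≤∣p∣+∣q∣ ⁅ c ⁆ (touched P.γ S.c′) ⟩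
      ∣ ⁅ c ⁆ ∣ + ∣ touched P.γ S.c′ ∣   ≡⟨ cong (_+ _) (∣⁅x⁆∣≡1 c) ⟩
      1 + ∣ touched P.γ S.c′ ∣           ≤⟨ s≤s P.γ-small ⟩
      suc (suc f)                        ∎
  ; ρ′-small = ≤-trans P.ρ′-small (m<n⇒m∸o≤n∸[1+o] f (p⊂q⇒∣p∣<∣q∣ S.shrinks))
  }
  where
    module S = Step s
    module P = Peeled p
    open ≤-Reasoning

peel : (f : ℕ) (ρ : Sym n) (c : Fin n) → Peeled f ρ c
peel zero    ρ c = unpeeled (∣p∣≤∣p∪q∣ (moved ρ) ⁅ c ⁆)
peel (suc f) ρ c with nonempty? (moved ρ)
... | yes ρ-moves = extend s (peel f (Step.ρ′ s) (Step.c′ s))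
  where
    s : Step ρ c
    s = step ρ-moves c
... | no  ρ-fixes = unpeeled (≤-trans (≤-reflexive (Empty⇒∣p∣≡0 ρ-fixes)) z≤n)

split : (f : ℕ) (ρ : Sym n) →
        ∃₂ λ γ ρ′ → ρ ≈ γ · ρ′ × ∣ moved γ ∣ ≤ suc f × ∣ moved ρ′ ∣ ≤ ∣ moved ρ ∣ ∸ f
split {n} f ρ with nonempty? (moved ρ)
... | yes (c , c∈) =
  γ , ρ′ , factor , ≤-trans (∣p∣≤∣p∪q∣ (moved γ) ⁅ c ⁆) γ-small ,
  ≤-trans ρ′-small (∸-monoˡ-≤ f (p⊆q⇒∣p∣≤∣q∣ (∪-lub (λ i∈ → i∈) (⁅x⁆⊆p c∈))))
  where open Peeled (peel f ρ c)
... | no  ρ-fixes =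
  id , ρ , (λ _ → refl) , ≤-trans (≤-reflexive (∣moved-id∣≡0 {n})) z≤n ,
  ≤-trans (≤-reflexive (Empty⇒∣p∣≡0 ρ-fixes)) z≤n

WalkBy : (Sym n → Set) → Sym n → ℕ → Set
WalkBy Γ ρ m = ∀ π σ → σ ≈ π · ρ → Walk Γ π σ m

walkBy-id : {Γ : Sym n → Set} {ρ : Sym n} → ρ ≈ id → WalkBy Γ ρ 0
walkBy-id ρ≈id π σ σ≈πρ = nil (λ i → sym (trans (σ≈πρ i) (cong (π ⟨$⟩ʳ_) (ρ≈id i))))

walkBy-· : {Γ : Sym n → Set} {γ ρ ρ′ : Sym n} {m : ℕ} →
           Γ γ → ρ ≈ γ · ρ′ → WalkBy Γ ρ′ m → WalkBy Γ ρ (suc m)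
walkBy-· {γ = γ} Γγ ρ≈γρ′ walk π σ σ≈πρ =
  cons (γ , Γγ , inj₁ (λ _ → refl)) (walk (π · γ) σ (λ i → trans (σ≈πρ i) (cong (π ⟨$⟩ʳ_) (ρ≈γρ′ i))))

walkBy-moved : (f t : ℕ) (ρ : Sym n) → ∣ moved ρ ∣ ≤ 1 + t * f → WalkBy (L (suc f) n) ρ t
walkBy-moved {n} f zero    ρ ρ-small = walkBy-id {Γ = L (suc f) n} {ρ} (∣moved∣≤1⇒≈id ρ ρ-small)
walkBy-moved {n} f (suc t) ρ ρ-small with split f ρ
... | γ , ρ′ , factor , γ-small , ρ′-small =
  walkBy-· {Γ = L (suc f) n} {γ} {ρ} {ρ′} γ∈L factor (walkBy-moved f t ρ′ ρ′-bound)
  where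
    γ∈L : L (suc f) n γ
    γ∈L = subst (_≤ suc f) (sym (supportSize≡∣moved∣ γ)) γ-small
    open ≤-Reasoning
    ρ′-bound : ∣ moved ρ′ ∣ ≤ 1 + t * f
    ρ′-bound = begin
      ∣ moved ρ′ ∣            ≤⟨ ρ′-small ⟩
      ∣ moved ρ ∣ ∸ f         ≤⟨ ∸-monoˡ-≤ f ρ-small ⟩
      suc (f + t * f) ∸ f     ≡⟨ cong (_∸ f) (sym (+-suc f (t * f))) ⟩
      f + (1 + t * f) ∸ f     ≡⟨ m+n∸m≡n f (1 + t * f) ⟩
      1 + t * f               ∎

m≤[m+j]/[1+j]*[1+j] : (m j : ℕ) → m ≤ (m + j) / suc j * suc j
m≤[m+j]/[1+j]*[1+j] m j = +-cancelʳ-≤ j m (q * suc j) (begin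
  m + j                       ≡⟨ m≡m%n+[m/n]*n (m + j) (suc j) ⟩
  (m + j) % suc j + q * suc j ≤⟨ +-monoˡ-≤ (q * suc j) (s≤s⁻¹ (m%n<n (m + j) (suc j))) ⟩
  j + q * suc j               ≡⟨ +-comm j (q * suc j) ⟩
  q * suc j + j               ∎)
  where
    open ≤-Reasoning
    q : ℕ
    q = (m + j) / suc j

lemma14 : (k n : ℕ) → 2 ≤ k → 2 ≤ n → DiamLe (L k n) (ceilDivPred (n ∸ 1) k)
lemma14 (suc zero)    _ (s≤s ()) _
lemma14 (suc (suc j)) n _ _ π σ =
  q , ≤-refl , walkBy-moved (suc j) q ρ ρ-small π σ (λ _ → sym (inverseʳ π))
  where
    open ≤-Reasoning
    q : ℕ
    q = (n ∸ 1 + j) / suc j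
    ρ : Sym n
    ρ = flip π · σ
    ρ-small : ∣ moved ρ ∣ ≤ 1 + q * suc j
    ρ-small = begin
      ∣ moved ρ ∣   ≤⟨ ∣p∣≤n (moved ρ) ⟩
      n             ≤⟨ m≤n+m∸n n 1 ⟩
      1 + (n ∸ 1)   ≤⟨ +-monoʳ-≤ 1 (m≤[m+j]/[1+j]*[1+j] (n ∸ 1) j) ⟩
      1 + q * suc j ∎
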